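{- Let $g:\{0,1\}^n\rightharpoonup\{0,1\}^n$ be a partial function with $g(P)=0^n$ for all $P\in\mathrm{dom}(g)$. Let $X\in\{0,1\}^n$ have Hamming distance at least $d$ from every point of $\mathrm{dom}(g)$. Then for every $Y\in\{0,1\}^n$ of Hamming weight at most $d$, $g$ can be extended to a total 1-Lipschitz function $\{0,1\}^n\to\{0,1\}^n$ with $g(X)=Y$.
   Context: A function $h:\{0,1\}^n\to\{0,1\}^n$ is 1-Lipschitz if for all $Z,Z'$ at Hamming distance $1$, $h(Z),h(Z')$ have Hamming distance at most $1$. -}

module Defs where

open import Data.Nat using (ℕ; zero; suc; _≤_)
open import Data.Bool using (Bool; true; false; _xor_)
open import Data.Vec using (Vec; []; _∷_; replicate; zipWith)
open import Data.Maybe using (Maybe; just)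
open import Relation.Binary.PropositionalEquality using (_≡_)

Cube : ℕ → Set
Cube n = Vec Bool n

weight : ∀ {n} → Cube n → ℕ
weight [] = 0
weight (true ∷ xs) = suc (weight xs)
weight (false ∷ xs) = weight xs

hamming : ∀ {n} → Cube n → Cube n → ℕ
hamming x y = weight (zipWith _xor_ x y)

zeros : ∀ {n} → Cube n
zeros {n} = replicate n false

OneLipschitz : ∀ {n} → (Cube n → Cube n) → Set
OneLipschitz {n} h = ∀ (Z Z′ : Cube n) → hamming Z Z′ ≡ 1 → hamming (h Z) (h Z′) ≤ 1

-- a partial function {0,1}^n ⇀ {0,1}^n is modelled as Cube n → Maybe (Cube n);
-- P ∈ dom g  iff  g P ≡ just v for some v.
-- h extends g: h agrees with g on dom g
Extends : ∀ {n} → (Cube n → Cube n) → (Cube n → Maybe (Cube n)) → Set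
Extends {n} h g = ∀ (P v : Cube n) → g P ≡ just v → h P ≡ v

-- Send Z to Y with its first  hamming X Z  ones cleared. At Z = X nothing is cleared, and on
-- dom g, where hamming X P ≥ d ≥ weight Y, everything is. Clearing j versus k ones moves the
-- image by at most ∣ j - k ∣, and Z ↦ hamming X Z is 1-Lipschitz by the triangle inequality,
-- so the whole map does not increase Hamming distance.
module Submission where

open import Defs
open import Data.Nat using (ℕ; zero; suc; _+_; _≤_; z≤n; s≤s; ∣_-_∣)
open import Data.Nat.Properties
  using (≤-reflexive; ≤-trans; +-mono-≤; +-commutativeSemigroup;
         ∣m-n∣≡[m∸n]∨[n∸m]; ∣-∣-identityʳ; m≤n+o⇒m∸n≤o; module ≤-Reasoning)
open import Data.Bool using (Bool; true; false; _xor_)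
open import Data.Bool.Properties using (xor-comm)
open import Data.Vec using ([]; _∷_; zipWith)
open import Data.Maybe using (Maybe; just)
open import Data.Product using (Σ; _×_; _,_)
open import Data.Sum using (inj₁; inj₂)
open import Relation.Binary.PropositionalEquality using (_≡_; refl; sym; trans; cong; cong₂; subst; module ≡-Reasoning)
open import Algebra.Properties.CommutativeSemigroup +-commutativeSemigroup using (interchange)

bitWeight : Bool → ℕ
bitWeight true  = 1
bitWeight false = 0

weight-∷ : ∀ {n} b (v : Cube n) → weight (b ∷ v) ≡ bitWeight b + weight v
weight-∷ true  v = refl
weight-∷ false v = refl

xor-triangle : ∀ a b c → bitWeight (a xor c) ≤ bitWeight (a xor b) + bitWeight (b xor c)
xor-triangle true  true  true  = z≤n
xor-triangle true  true  false = s≤s z≤n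
xor-triangle true  false true  = z≤n
xor-triangle true  false false = s≤s z≤n
xor-triangle false true  true  = s≤s z≤n
xor-triangle false true  false = z≤n
xor-triangle false false true  = s≤s z≤n
xor-triangle false false false = z≤n

hamming-∷ : ∀ {n} a b (x y : Cube n) → hamming (a ∷ x) (b ∷ y) ≡ bitWeight (a xor b) + hamming x y
hamming-∷ a b x y = weight-∷ (a xor b) (zipWith _xor_ x y)

hamming-self : ∀ {n} (x : Cube n) → hamming x x ≡ 0
hamming-self []          = refl
hamming-self (true  ∷ x) = hamming-self x
hamming-self (false ∷ x) = hamming-self x

hamming-sym : ∀ {n} (x y : Cube n) → hamming x y ≡ hamming y x
hamming-sym []      []      = refl
hamming-sym (a ∷ x) (b ∷ y) = begin
  hamming (a ∷ x) (b ∷ y)           ≡⟨ hamming-∷ a b x y ⟩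
  bitWeight (a xor b) + hamming x y ≡⟨ cong₂ _+_ (cong bitWeight (xor-comm a b)) (hamming-sym x y) ⟩
  bitWeight (b xor a) + hamming y x ≡⟨ sym (hamming-∷ b a y x) ⟩
  hamming (b ∷ y) (a ∷ x)           ∎
  where open ≡-Reasoning

hamming-triangle : ∀ {n} (x y z : Cube n) → hamming x z ≤ hamming x y + hamming y z
hamming-triangle []      []      []      = z≤n
hamming-triangle (a ∷ x) (b ∷ y) (c ∷ z) = begin
  hamming (a ∷ x) (c ∷ z)
    ≡⟨ hamming-∷ a c x z ⟩
  bitWeight (a xor c) + hamming x z
    ≤⟨ +-mono-≤ (xor-triangle a b c) (hamming-triangle x y z) ⟩
  (bitWeight (a xor b) + bitWeight (b xor c)) + (hamming x y + hamming y z)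
    ≡⟨ interchange (bitWeight (a xor b)) _ _ _ ⟩
  (bitWeight (a xor b) + hamming x y) + (bitWeight (b xor c) + hamming y z)
    ≡⟨ sym (cong₂ _+_ (hamming-∷ a b x y) (hamming-∷ b c y z)) ⟩
  hamming (a ∷ x) (b ∷ y) + hamming (b ∷ y) (c ∷ z) ∎
  where open ≤-Reasoning

∣-∣-≤ : ∀ {m n o} → m ≤ n + o → n ≤ m + o → ∣ m - n ∣ ≤ o
∣-∣-≤ {m} {n} m≤n+o n≤m+o with ∣m-n∣≡[m∸n]∨[n∸m] m n
... | inj₁ eq = subst (_≤ _) (sym eq) (m≤n+o⇒m∸n≤o m n m≤n+o)
... | inj₂ eq = subst (_≤ _) (sym eq) (m≤n+o⇒m∸n≤o n m n≤m+o)

hamming-reverse-triangle : ∀ {n} (x y z : Cube n) → ∣ hamming x y - hamming x z ∣ ≤ hamming y z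
hamming-reverse-triangle x y z = ∣-∣-≤
  (subst (hamming x y ≤_) (cong (hamming x z +_) (hamming-sym z y)) (hamming-triangle x z y))
  (hamming-triangle x y z)

clearOnes : ∀ {n} → ℕ → Cube n → Cube n
clearOnes zero    y           = y
clearOnes (suc k) []          = []
clearOnes (suc k) (false ∷ y) = false ∷ clearOnes (suc k) y
clearOnes (suc k) (true  ∷ y) = false ∷ clearOnes k y

clearOnes-all : ∀ {n} k (y : Cube n) → weight y ≤ k → clearOnes k y ≡ zeros
clearOnes-all zero    []          _         = refl
clearOnes-all zero    (false ∷ y) w≤0       = cong (false ∷_) (clearOnes-all zero y w≤0)
clearOnes-all (suc k) []          _         = refl
clearOnes-all (suc k) (false ∷ y) w≤k       = cong (false ∷_) (clearOnes-all (suc k) y w≤k)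
clearOnes-all (suc k) (true  ∷ y) (s≤s w≤k) = cong (false ∷_) (clearOnes-all k y w≤k)

hamming-clearOnes : ∀ {n} j k (y : Cube n) → hamming (clearOnes j y) (clearOnes k y) ≤ ∣ j - k ∣
hamming-clearOnes zero    zero    y           = ≤-reflexive (hamming-self y)
hamming-clearOnes zero    (suc k) []          = z≤n
hamming-clearOnes zero    (suc k) (false ∷ y) = hamming-clearOnes zero (suc k) y
hamming-clearOnes zero    (suc k) (true  ∷ y) = s≤s (hamming-clearOnes zero k y)
hamming-clearOnes (suc j) zero    []          = z≤n
hamming-clearOnes (suc j) zero    (false ∷ y) = hamming-clearOnes (suc j) zero y
hamming-clearOnes (suc j) zero    (true  ∷ y) = s≤s (≤-trans (hamming-clearOnes j zero y) (≤-reflexive (∣-∣-identityʳ j)))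
hamming-clearOnes (suc j) (suc k) []          = z≤n
hamming-clearOnes (suc j) (suc k) (false ∷ y) = hamming-clearOnes (suc j) (suc k) y
hamming-clearOnes (suc j) (suc k) (true  ∷ y) = hamming-clearOnes j k y

lemma24 : (n d : ℕ) (g : Cube n → Maybe (Cube n))
    → (∀ (P v : Cube n) → g P ≡ just v → v ≡ zeros)
    → (X : Cube n)
    → (∀ (P v : Cube n) → g P ≡ just v → d ≤ hamming X P)
    → (Y : Cube n) → weight Y ≤ d
    → Σ (Cube n → Cube n) (λ h → Extends h g × OneLipschitz h × h X ≡ Y)
lemma24 n d g g≡zeros X far Y weightY≤d = h , extends , lipschitz , hX≡Y
  where
  h : Cube n → Cube n
  h Z = clearOnes (hamming X Z) Y

  extends : Extends h g
  extends P v gP≡v = trans (clearOnes-all (hamming X P) Y (≤-trans weightY≤d (far P v gP≡v)))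
                           (sym (g≡zeros P v gP≡v))

  lipschitz : OneLipschitz h
  lipschitz Z Z′ dist≡1 = begin
    hamming (h Z) (h Z′)            ≤⟨ hamming-clearOnes (hamming X Z) (hamming X Z′) Y ⟩
    ∣ hamming X Z - hamming X Z′ ∣  ≤⟨ hamming-reverse-triangle X Z Z′ ⟩
    hamming Z Z′                    ≡⟨ dist≡1 ⟩
    1                               ∎
    where open ≤-Reasoning

  hX≡Y : h X ≡ Y
  hX≡Y = cong (λ k → clearOnes k Y) (hamming-self X)
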